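{- Let $\vdash$ be a finitary logic satisfying the standing assumption below (in particular having the partition function $\pi$) and without antitheorems. Then: (i) there are at most four proper sublogics of variable inclusion of $\vdash$ (namely among $\vdash^l,\vdash^r,\vdash^{lr},\vdash^{rl}$); (ii) the sublattice of the lattice of all logics over the given language generated by $\mathcal{SV}(\vdash)$ has at most six elements, namely $\vdash$, $\vdash^l\vee\vdash^r$, $\vdash^l$, $\vdash^r$, $\vdash^{lr}=\vdash^l\cap\vdash^r$, and $\vdash^{rl}$ ($=\vdash^{rl\bullet}=\vdash^{lrl\bullet}$ for every finite sequence $\bullet$ over $\{l,r\}$), ordered as follows: $\vdash^{rl}\leq\vdash^{lr}\leq\vdash^l,\vdash^r\leq\vdash^l\vee\vdash^r\leq\vdash$.
   Context: Fix an algebraic language and let $Fm$ be the set of formulas built over a countably infinite set $\mathrm{Var}$ of variables. For a formula $\varphi$, $\mathrm{Var}(\varphi)$ is the set of variables occurring in $\varphi$, and for $\Gamma\subseteq Fm$, $\mathrm{Var}(\Gamma)=\bigcup_{\gamma\in\Gamma}\mathrm{Var}(\gamma)$. A logic is a consequence relation $\vdash\subseteq\mathcal{P}(Fm)\times Fm$ invariant under substitutions; it is finitary if $\Gamma\vdash\varphi$ iff $\Delta\vdash\varphi$ for some finite $\Delta\subseteq\Gamma$. The logics over the language form a complete lattice under inclusion $\leq$, with meet $\cap$ (intersection) and join $\vee$ (the least logic containing both). A set $\Sigma$ of formulas is an antitheorem of $\vdash$ if $\sigma[\Sigma]\vdash\varphi$ for every substitution $\sigma$ and every formula $\varphi$.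 For a logic $\vdash$: $\Gamma\vdash^{l}\varphi$ iff there is $\Delta\subseteq\Gamma$ with $\mathrm{Var}(\Delta)\subseteq\mathrm{Var}(\varphi)$ and $\Delta\vdash\varphi$; $\Gamma\vdash^{r}\varphi$ iff either ($\Gamma\vdash\varphi$ and $\mathrm{Var}(\varphi)\subseteq\mathrm{Var}(\Gamma)$) or $\Sigma\subseteq\Gamma$ for some antitheorem $\Sigma$ of $\vdash$. For a finite sequence $u_1\dots u_n$ over $\{l,r\}$, $\vdash^{u_1\dots u_n}$ is the result of applying the operation $u_n$ to $\vdash^{u_1\dots u_{n-1}}$ (the empty sequence gives $\vdash$); juxtaposition denotes concatenation. The sublogics of variable inclusion of $\vdash$ are the logics $\vdash^{\bullet}$ for nonempty finite sequences $\bullet$ over $\{l,r\}$, and $\mathcal{SV}(\vdash)$ denotes the set of them. Standing assumption: $\vdash$ is finitary and there is a binary formula $\pi(x,y)$, in which $x$ and $y$ really occur, that is an $l$-partition function for $\vdash^l$ and an $r$-partition function for $\vdash^r$. Here: for a logic $\vdash'$, $\mathrm{Alg}(\vdash')$ is the class of algebraic reducts of the reduced matrix models of $\vdash'$; a binary operation $\cdot$ on an algebra is a partition function if for all $a,b,c$ and every basic operation $g$ of arity $n\ge1$: $a\cdot a=a$; $a\cdot(b\cdot c)=(a\cdot b)\cdot c$; $a\cdot(b\cdot c)=a\cdot(c\cdot b)$; $g(a_1,\dots,a_n)\cdot b=g(a_1\cdot b,\dots,a_n\cdot b)$; $b\cdot g(a_1,\dots,a_n)=b\cdot a_1\cdot\ldots\cdot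 a_n$. A formula $x\cdot y$ is an $l$-partition function for $\vdash'$ if $x\vdash' x\cdot y$ and these five conditions hold as equations in every algebra of $\mathrm{Alg}(\vdash')$; a formula $x\ast y$ is an $r$-partition function for $\vdash'$ if $x,y\vdash' x\ast y$, $x\ast y\vdash' x$, and $\ast$ is a partition function in every algebra of $\mathrm{Alg}(\vdash')$. -}

module Defs where

open import Level using (0ℓ) renaming (suc to lsuc)
open import Data.Nat using (ℕ; zero; suc; _≟_)
open import Data.Fin using (Fin)
open import Data.Bool using (if_then_else_)
open import Data.List using (List; []; _∷_; foldl; tabulate)
open import Data.List.Membership.Propositional renaming (_∈_ to _∈L_)
open import Data.Product using (Σ; ∃; _×_; _,_)
open import Data.Sum using (_⊎_)
open import Relation.Unary using (Pred; _∈_; _⊆_)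
open import Relation.Binary.PropositionalEquality using (_≡_; _≢_)
open import Relation.Binary.Structures using (IsEquivalence)
open import Relation.Nullary using (¬_; does)

record Language : Set₁ where
  field
    Op    : Set
    arity : Op → ℕ

module WithLanguage (𝓛 : Language) where
  open Language 𝓛

  data Fm : Set where
    var : ℕ → Fm
    app : (f : Op) → (Fin (arity f) → Fm) → Fm

  data _occursIn_ (x : ℕ) : Fm → Set where
    here  : x occursIn var x
    there : ∀ {f} {as : Fin (arity f) → Fm} (i : Fin (arity f)) →
            x occursIn as i → x occursIn app f as

  Subst : Set
  Subst = ℕ → Fm

  sub : Subst → Fm → Fm
  sub σ (var n)    = σ n
  sub σ (app f as) = app f (λ i → sub σ (as i))

  FmSet : Set₁
  FmSet = Pred Fm 0ℓ

  VarOf : FmSet → ℕ → Set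
  VarOf Γ x = ∃ λ γ → Γ γ × x occursIn γ

  image : Subst → FmSet → FmSet
  image σ Γ ψ = ∃ λ δ → Γ δ × sub σ δ ≡ ψ

  Cons : Set₂
  Cons = FmSet → Fm → Set₁

  record IsLogic (⊢ : Cons) : Set₂ where
    field
      reflexive  : ∀ {Γ φ} → Γ φ → ⊢ Γ φ
      monotone   : ∀ {Γ Δ φ} → Γ ⊆ Δ → ⊢ Γ φ → ⊢ Δ φ
      cut        : ∀ {Γ Δ φ} → (∀ {δ} → Δ δ → ⊢ Γ δ) → ⊢ Δ φ → ⊢ Γ φ
      structural : ∀ {Γ φ} (σ : Subst) → ⊢ Γ φ → ⊢ (image σ Γ) (sub σ φ)

  listSet : List Fm → FmSet
  listSet Δ ψ = ψ ∈L Δ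

  -- finitarity (the converse direction follows from monotonicity)
  Finitary : Cons → Set₁
  Finitary ⊢ = ∀ Γ φ → ⊢ Γ φ →
    ∃ λ (Δ : List Fm) → (∀ δ → δ ∈L Δ → Γ δ) × ⊢ (listSet Δ) φ

  Antitheorem : Cons → FmSet → Set₁
  Antitheorem ⊢ Σ' = ∀ (σ : Subst) (φ : Fm) → ⊢ (image σ Σ') φ

  HasAntitheorem : Cons → Set₁
  HasAntitheorem ⊢ = Σ FmSet (Antitheorem ⊢)

  lOp : Cons → Cons
  lOp ⊢ Γ φ = Σ FmSet λ Δ → Δ ⊆ Γ × (∀ x → VarOf Δ x → x occursIn φ) × ⊢ Δ φ

  rOp : Cons → Cons
  rOp ⊢ Γ φ = (⊢ Γ φ × (∀ x → x occursIn φ → VarOf Γ x))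
            ⊎ (Σ FmSet λ Σ' → Antitheorem ⊢ Σ' × Σ' ⊆ Γ)

  data LR : Set where
    l r : LR

  applyLR : LR → Cons → Cons
  applyLR l = lOp
  applyLR r = rOp

  -- ⊢^{u₁…uₙ} : apply u₁ first, uₙ last
  iter : Cons → List LR → Cons
  iter ⊢ s = foldl (λ L u → applyLR u L) ⊢ s

  _∩_ : Cons → Cons → Cons
  (A ∩ B) Γ φ = A Γ φ × B Γ φ

  data Join (A B : Cons) (Γ : FmSet) : Fm → Set₁ where
    base  : ∀ {φ} → Γ φ → Join A B Γ φ
    ruleA : ∀ {Δ ψ} → A Δ ψ → (∀ {δ} → Δ δ → Join A B Γ δ) → Join A B Γ ψ
    ruleB : ∀ {Δ ψ} → B Δ ψ → (∀ {δ} → Δ δ → Join A B Γ δ) → Join A B Γ ψ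

  _∨_ : Cons → Cons → Cons
  A ∨ B = Join A B

  _≤_ : Cons → Cons → Set₁
  A ≤ B = ∀ {Γ φ} → A Γ φ → B Γ φ

  _≅_ : Cons → Cons → Set₁
  A ≅ B = (A ≤ B) × (B ≤ A)

  data Gen (⊢ : Cons) : Cons → Set₃ where
    sv   : (u : LR) (s : List LR) → Gen ⊢ (iter ⊢ (u ∷ s))
    meet : ∀ {A B} → Gen ⊢ A → Gen ⊢ B → Gen ⊢ (A ∩ B)
    join : ∀ {A B} → Gen ⊢ A → Gen ⊢ B → Gen ⊢ (A ∨ B)

  record Algebra : Set₂ where
    field
      Carrier : Set
      _≈_     : Carrier → Carrier → Set₁
      isEquiv : IsEquivalence _≈_
      ⟦_⟧     : (f : Op) → (Fin (arity f) → Carrier) → Carrier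
      ⟦⟧-cong : ∀ f {as bs} → (∀ i → as i ≈ bs i) → ⟦ f ⟧ as ≈ ⟦ f ⟧ bs

  module _ (A : Algebra) where
    open Algebra A

    eval : (ℕ → Carrier) → Fm → Carrier
    eval h (var n)    = h n
    eval h (app f as) = ⟦ f ⟧ (λ i → eval h (as i))

    record IsCongruence (θ : Carrier → Carrier → Set₁) : Set₁ where
      field
        equiv    : IsEquivalence θ
        ≈⊆θ      : ∀ {a b} → a ≈ b → θ a b
        compat   : ∀ f {as bs} → (∀ i → θ (as i) (bs i)) → θ (⟦ f ⟧ as) (⟦ f ⟧ bs)

    IsFilterPred : (Carrier → Set₁) → Set₁
    IsFilterPred F = ∀ {a b} → a ≈ b → F a → F b

    IsModel : Cons → (Carrier → Set₁) → Set₁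
    IsModel ⊢ F = ∀ Γ φ → ⊢ Γ φ → ∀ (h : ℕ → Carrier) →
      (∀ γ → Γ γ → F (eval h γ)) → F (eval h φ)

    -- reduced: the Leibniz congruence is the identity (≈), i.e. every
    -- congruence compatible with F is contained in ≈
    IsReduced : (Carrier → Set₁) → Set₂
    IsReduced F = ∀ (θ : Carrier → Carrier → Set₁) → IsCongruence θ →
      (∀ {a b} → θ a b → F a → F b) → ∀ {a b} → θ a b → a ≈ b

    InAlg : Cons → Set₂
    InAlg ⊢ = Σ (Carrier → Set₁) λ F → IsFilterPred F × IsModel ⊢ F × IsReduced F

    record IsPartitionFunction (_·_ : Carrier → Carrier → Carrier) : Set₁ where
      field
        idem   : ∀ a → (a · a) ≈ a
        assoc  : ∀ a b c → (a · (b · c)) ≈ ((a · b) · c)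
        comm   : ∀ a b c → (a · (b · c)) ≈ (a · (c · b))
        distL  : ∀ g → arity g ≢ 0 → ∀ (as : Fin (arity g) → Carrier) b →
                 (⟦ g ⟧ as · b) ≈ ⟦ g ⟧ (λ i → as i · b)
        distR  : ∀ g → arity g ≢ 0 → ∀ (as : Fin (arity g) → Carrier) b →
                 (b · ⟦ g ⟧ as) ≈ foldl _·_ b (tabulate as)

    piOp : ℕ → Fm → Carrier → Carrier → Carrier
    piOp y π a b = eval (λ n → if does (n ≟ y) then b else a) π

  IsBinaryFormula : ℕ → ℕ → Fm → Set
  IsBinaryFormula x y π =
    x ≢ y × x occursIn π × y occursIn π × (∀ z → z occursIn π → z ≡ x ⊎ z ≡ y)

  IsLPartition : Cons → ℕ → ℕ → Fm → Set₂
  IsLPartition ⊢ x y π =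
    ⊢ (λ ψ → ψ ≡ var x) π
    × (∀ (A : Algebra) → InAlg A ⊢ → IsPartitionFunction A (piOp A y π))

  IsRPartition : Cons → ℕ → ℕ → Fm → Set₂
  IsRPartition ⊢ x y π =
    ⊢ (λ ψ → ψ ≡ var x ⊎ ψ ≡ var y) π
    × ⊢ (λ ψ → ψ ≡ π) (var x)
    × (∀ (A : Algebra) → InAlg A ⊢ → IsPartitionFunction A (piOp A y π))

module Submission where

-- Without antitheorems the operation r only adds the side condition Var(φ) ⊆ Var(Γ), while l
-- only keeps derivations from premises Δ ⊆ Γ with Var(Δ) ⊆ Var(φ). Both are decreasing,
-- monotone and idempotent, and two absorption laws hold: lrl = rl, and rlr = rl because l
-- preserves variable inclusion.
-- So every word in l and r reduces to one of l, r, lr, rl. These satisfy rl ≤ lr = l ∩ r with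
-- l, r ≤ l ∨ r ≤ ⊢, and this six-element poset is closed under ∩ and ∨ because any two of its
-- elements other than l, r are comparable.

open import Defs
open import Data.Nat using (ℕ)
open import Data.List using (List; []; _∷_; foldl)
open import Data.Product using (_×_; Σ; _,_; proj₁; proj₂)
open import Data.Sum using (_⊎_; inj₁; inj₂)
open import Data.Empty using (⊥-elim)
open import Function using (id)
open import Relation.Nullary using (¬_)
open import Relation.Unary using (_⊆_)
open import Relation.Binary.PropositionalEquality using (_≡_; refl; subst)

module SublogicsOfVariableInclusion (𝓛 : Language) where
  open WithLanguage 𝓛

  ≅-refl : ∀ {A} → A ≅ A
  ≅-refl = id , id

  ≅-sym : ∀ {A B} → A ≅ B → B ≅ A
  ≅-sym (f , g) = g , f

  ≅-trans : ∀ {A B C} → A ≅ B → B ≅ C → A ≅ C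
  ≅-trans (f , g) (f′ , g′) = (λ p → f′ (f p)) , (λ p → g (g′ p))

  Monotone : Cons → Set₁
  Monotone A = ∀ {Γ Δ φ} → Γ ⊆ Δ → A Γ φ → A Δ φ

  record IsConsequence (A : Cons) : Set₂ where
    field
      reflexive : ∀ {Γ φ} → Γ φ → A Γ φ
      monotone  : Monotone A
      cut       : ∀ {Γ Δ φ} → (∀ {δ} → Δ δ → A Γ δ) → A Δ φ → A Γ φ

  isLogic⇒isConsequence : ∀ {A} → IsLogic A → IsConsequence A
  isLogic⇒isConsequence L = record
    { reflexive = IsLogic.reflexive L ; monotone = IsLogic.monotone L ; cut = IsLogic.cut L }

  isConsequence-≅ : ∀ {A B} → A ≅ B → IsConsequence B → IsConsequence A
  isConsequence-≅ (f , g) B = record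
    { reflexive = λ γ → g (reflexive γ)
    ; monotone  = λ Γ⊆Δ p → g (monotone Γ⊆Δ (f p))
    ; cut       = λ h p → g (cut (λ δ → f (h δ)) (f p))
    }
    where open IsConsequence B

  _⊆ⱽ_ : Fm → FmSet → Set
  φ ⊆ⱽ Γ = ∀ x → x occursIn φ → VarOf Γ x

  ∈⇒⊆ⱽ : ∀ {Γ φ} → Γ φ → φ ⊆ⱽ Γ
  ∈⇒⊆ⱽ φ∈Γ x x∈φ = _ , φ∈Γ , x∈φ

  ⊆ⱽ-weaken : ∀ {φ Γ Δ} → Γ ⊆ Δ → φ ⊆ⱽ Γ → φ ⊆ⱽ Δ
  ⊆ⱽ-weaken Γ⊆Δ φ⊆Γ x x∈φ = let (γ , γ∈Γ , x∈γ) = φ⊆Γ x x∈φ in γ , Γ⊆Δ γ∈Γ , x∈γ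

  ⊆ⱽ-trans : ∀ {φ Δ Γ} → φ ⊆ⱽ Δ → (∀ {δ} → Δ δ → δ ⊆ⱽ Γ) → φ ⊆ⱽ Γ
  ⊆ⱽ-trans φ⊆Δ Δ⊆Γ x x∈φ = let (δ , δ∈Δ , x∈δ) = φ⊆Δ x x∈φ in Δ⊆Γ δ∈Δ x x∈δ

  VariableInclusive : Cons → Set₁
  VariableInclusive A = ∀ {Γ φ} → A Γ φ → φ ⊆ⱽ Γ

  ¬HasAntitheorem-≤ : ∀ {A B} → A ≤ B → ¬ HasAntitheorem B → ¬ HasAntitheorem A
  ¬HasAntitheorem-≤ A≤B noB (Σ′ , anti) = noB (Σ′ , λ σ φ → A≤B (anti σ φ))

  lOp-mono : ∀ {A B} → A ≤ B → lOp A ≤ lOp B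
  lOp-mono A≤B (Δ , Δ⊆Γ , vars , p) = Δ , Δ⊆Γ , vars , A≤B p

  lOp-cong : ∀ {A B} → A ≅ B → lOp A ≅ lOp B
  lOp-cong {A} {B} (f , g) = lOp-mono {A} {B} f , lOp-mono {B} {A} g

  lOp-≤ : ∀ {A} → Monotone A → lOp A ≤ A
  lOp-≤ mono (Δ , Δ⊆Γ , _ , p) = mono Δ⊆Γ p

  lOp-idem : ∀ {A} → lOp (lOp A) ≅ lOp A
  lOp-idem = (λ { (_ , Δ⊆Γ , _ , (E , E⊆Δ , vars , p)) → E , (λ e → Δ⊆Γ (E⊆Δ e)) , vars , p })
           , (λ { (Δ , Δ⊆Γ , vars , p) → Δ , Δ⊆Γ , vars , (Δ , id , vars , p) })

  lOp-variableInclusive : ∀ {A} → VariableInclusive A → VariableInclusive (lOp A)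
  lOp-variableInclusive inclusive (_ , Δ⊆Γ , _ , p) = ⊆ⱽ-weaken Δ⊆Γ (inclusive p)

  lOp-isConsequence : ∀ {A} → IsConsequence A → IsConsequence (lOp A)
  lOp-isConsequence {A} isA = record { reflexive = reflexiveˡ ; monotone = monotoneˡ ; cut = cutˡ }
    where
    open IsConsequence isA

    reflexiveˡ : ∀ {Γ φ} → Γ φ → lOp A Γ φ
    reflexiveˡ {φ = φ} φ∈Γ =
      (_≡ φ) , (λ { refl → φ∈Γ }) , (λ { x (_ , refl , x∈φ) → x∈φ }) , reflexive refl

    monotoneˡ : Monotone (lOp A)
    monotoneˡ Γ⊆Γ′ (Δ , Δ⊆Γ , vars , p) = Δ , (λ δ → Γ⊆Γ′ (Δ⊆Γ δ)) , vars , p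

    -- The premises of the combined derivation are the union of those used for each δ ∈ D.
    cutˡ : ∀ {Γ Δ φ} → (∀ {δ} → Δ δ → lOp A Γ δ) → lOp A Δ φ → lOp A Γ φ
    cutˡ {Γ} {Δ} {φ} h (D , D⊆Δ , varsD , p) = E , E⊆Γ , varsE , cut derive p
      where
      E : FmSet
      E ψ = Σ Fm λ δ → Σ (D δ) λ δ∈D → proj₁ (h (D⊆Δ δ∈D)) ψ

      E⊆Γ : E ⊆ Γ
      E⊆Γ (_ , δ∈D , e) = proj₁ (proj₂ (h (D⊆Δ δ∈D))) e

      varsE : ∀ x → VarOf E x → x occursIn φ
      varsE x (ψ , (δ , δ∈D , e) , x∈ψ) =
        varsD x (δ , δ∈D , proj₁ (proj₂ (proj₂ (h (D⊆Δ δ∈D)))) x (ψ , e , x∈ψ))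

      derive : ∀ {δ} → D δ → A E δ
      derive {δ} δ∈D = monotone (λ e → δ , δ∈D , e) (proj₂ (proj₂ (proj₂ (h (D⊆Δ δ∈D)))))

  rOp₀ : Cons → Cons
  rOp₀ A Γ φ = A Γ φ × φ ⊆ⱽ Γ

  rOp₀-isConsequence : ∀ {A} → IsConsequence A → IsConsequence (rOp₀ A)
  rOp₀-isConsequence isA = record
    { reflexive = λ φ∈Γ → reflexive φ∈Γ , ∈⇒⊆ⱽ φ∈Γ
    ; monotone  = λ Γ⊆Δ (p , vars) → monotone Γ⊆Δ p , ⊆ⱽ-weaken Γ⊆Δ vars
    ; cut       = λ h (p , vars) → cut (λ δ → proj₁ (h δ)) p , ⊆ⱽ-trans vars (λ δ → proj₂ (h δ))
    }
    where open IsConsequence isA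

  rOp-mono : ∀ {A B} → A ≤ B → rOp A ≤ rOp B
  rOp-mono A≤B (inj₁ (p , vars))       = inj₁ (A≤B p , vars)
  rOp-mono A≤B (inj₂ (Σ′ , anti , Σ′⊆Γ)) = inj₂ (Σ′ , (λ σ φ → A≤B (anti σ φ)) , Σ′⊆Γ)

  rOp-cong : ∀ {A B} → A ≅ B → rOp A ≅ rOp B
  rOp-cong {A} {B} (f , g) = rOp-mono {A} {B} f , rOp-mono {B} {A} g

  rOp-monotone : ∀ {A} → Monotone A → Monotone (rOp A)
  rOp-monotone mono Γ⊆Δ (inj₁ (p , vars))       = inj₁ (mono Γ⊆Δ p , ⊆ⱽ-weaken Γ⊆Δ vars)
  rOp-monotone mono Γ⊆Δ (inj₂ (Σ′ , anti , Σ′⊆Γ)) = inj₂ (Σ′ , anti , λ s → Γ⊆Δ (Σ′⊆Γ s))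

  module _ {A : Cons} (noA : ¬ HasAntitheorem A) where

    rOp≅rOp₀ : rOp A ≅ rOp₀ A
    rOp≅rOp₀ = (λ { (inj₁ p) → p ; (inj₂ (Σ′ , anti , _)) → ⊥-elim (noA (Σ′ , anti)) }) , inj₁

    rOp-≤ : rOp A ≤ A
    rOp-≤ p = proj₁ (proj₁ rOp≅rOp₀ p)

    rOp-variableInclusive : VariableInclusive (rOp A)
    rOp-variableInclusive p = proj₂ (proj₁ rOp≅rOp₀ p)

    rOp-absorb : VariableInclusive A → rOp A ≅ A
    rOp-absorb inclusive = rOp-≤ , λ p → inj₁ (p , inclusive p)

    rOp-isConsequence : IsConsequence A → IsConsequence (rOp A)
    rOp-isConsequence isA = isConsequence-≅ rOp≅rOp₀ (rOp₀-isConsequence isA)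

  rOp-idem : ∀ {A} → ¬ HasAntitheorem A → rOp (rOp A) ≅ rOp A
  rOp-idem {A} noA = rOp-absorb {rOp A} (¬HasAntitheorem-≤ {rOp A} (rOp-≤ {A} noA) noA) (rOp-variableInclusive {A} noA)

  module _ {A : Cons} (mono : Monotone A) (noA : ¬ HasAntitheorem A) where

    private
      noAˡ : ¬ HasAntitheorem (lOp A)
      noAˡ = ¬HasAntitheorem-≤ {lOp A} {A} (lOp-≤ {A} mono) noA

    lr≤l : rOp (lOp A) ≤ lOp A
    lr≤l = rOp-≤ {lOp A} noAˡ

    lr≤r : rOp (lOp A) ≤ rOp A
    lr≤r = rOp-mono {lOp A} {A} (lOp-≤ {A} mono)

    rl≤lr : lOp (rOp A) ≤ rOp (lOp A)
    rl≤lr (Δ , Δ⊆Γ , vars , q) = let (p , φ⊆Δ) = proj₁ (rOp≅rOp₀ {A} noA) q in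
      inj₁ ((Δ , Δ⊆Γ , vars , p) , ⊆ⱽ-weaken Δ⊆Γ φ⊆Δ)

    l∩r≅lr : (lOp A ∩ rOp A) ≅ rOp (lOp A)
    l∩r≅lr = (λ (p , q) → inj₁ (p , rOp-variableInclusive {A} noA q))
           , (λ q → lr≤l q , lr≤r q)

    -- A derivation from Δ whose conclusion contains all variables of Δ serves as its own l-witness.
    lrl≅rl : lOp (rOp (lOp A)) ≅ lOp (rOp A)
    lrl≅rl = (λ (Δ , Δ⊆Γ , vars , q) → let (p , φ⊆Δ) = proj₁ (rOp≅rOp₀ {lOp A} noAˡ) q in
                Δ , Δ⊆Γ , vars , inj₁ (lOp-≤ {A} mono p , φ⊆Δ))
           , (λ (Δ , Δ⊆Γ , vars , q) → let (p , φ⊆Δ) = proj₁ (rOp≅rOp₀ {A} noA) q in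
                Δ , Δ⊆Γ , vars , inj₁ ((Δ , id , vars , p) , φ⊆Δ))

    rlr≅rl : rOp (lOp (rOp A)) ≅ lOp (rOp A)
    rlr≅rl = rOp-absorb {lOp (rOp A)} (¬HasAntitheorem-≤ {lOp (rOp A)} {rOp A} (lOp-≤ {rOp A} (rOp-monotone {A} mono)) noAʳ)
                                    (lOp-variableInclusive (rOp-variableInclusive {A} noA))
      where
      noAʳ : ¬ HasAntitheorem (rOp A)
      noAʳ = ¬HasAntitheorem-≤ {rOp A} {A} (rOp-≤ {A} noA) noA

  ∩-cong : ∀ {A B A′ B′} → A ≅ A′ → B ≅ B′ → (A ∩ B) ≅ (A′ ∩ B′)
  ∩-cong (f , f′) (g , g′) = (λ (a , b) → f a , g b) , (λ (a , b) → f′ a , g′ b)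

  ∩-comm : ∀ {A B} → (A ∩ B) ≅ (B ∩ A)
  ∩-comm = (λ (a , b) → b , a) , (λ (b , a) → a , b)

  x≤y⇒x∩y≅x : ∀ {A B} → A ≤ B → (A ∩ B) ≅ A
  x≤y⇒x∩y≅x A≤B = proj₁ , λ a → a , A≤B a

  y≤x⇒x∩y≅y : ∀ {A B} → B ≤ A → (A ∩ B) ≅ B
  y≤x⇒x∩y≅y B≤A = proj₂ , λ b → B≤A b , b

  module _ {A B : Cons} where

    ∨-upperˡ : A ≤ (A ∨ B)
    ∨-upperˡ a = ruleA a base

    ∨-upperʳ : B ≤ (A ∨ B)
    ∨-upperʳ b = ruleB b base

    ∨-cut : ∀ {Γ Δ φ} → (∀ {δ} → Δ δ → (A ∨ B) Γ δ) → (A ∨ B) Δ φ → (A ∨ B) Γ φ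
    ∨-cut h (base δ)    = h δ
    ∨-cut h (ruleA a k) = ruleA a (λ δ → ∨-cut h (k δ))
    ∨-cut h (ruleB b k) = ruleB b (λ δ → ∨-cut h (k δ))

    ∨-isConsequence : IsConsequence (A ∨ B)
    ∨-isConsequence = record
      { reflexive = base ; monotone = λ Γ⊆Δ → ∨-cut (λ γ → base (Γ⊆Δ γ)) ; cut = ∨-cut }

    ∨-least : ∀ {C} → A ≤ C → B ≤ C → IsConsequence C → (A ∨ B) ≤ C
    ∨-least A≤C B≤C isC (base γ)    = IsConsequence.reflexive isC γ
    ∨-least A≤C B≤C isC (ruleA a k) = IsConsequence.cut isC (λ δ → ∨-least A≤C B≤C isC (k δ)) (A≤C a)
    ∨-least A≤C B≤C isC (ruleB b k) = IsConsequence.cut isC (λ δ → ∨-least A≤C B≤C isC (k δ)) (B≤C b)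

  ∨-mono : ∀ {A B A′ B′} → A ≤ A′ → B ≤ B′ → (A ∨ B) ≤ (A′ ∨ B′)
  ∨-mono f g (base γ)    = base γ
  ∨-mono f g (ruleA a k) = ruleA (f a) (λ δ → ∨-mono f g (k δ))
  ∨-mono f g (ruleB b k) = ruleB (g b) (λ δ → ∨-mono f g (k δ))

  ∨-cong : ∀ {A B A′ B′} → A ≅ A′ → B ≅ B′ → (A ∨ B) ≅ (A′ ∨ B′)
  ∨-cong (f , f′) (g , g′) = ∨-mono f g , ∨-mono f′ g′

  ∨-comm : ∀ {A B} → (A ∨ B) ≅ (B ∨ A)
  ∨-comm = ∨-least ∨-upperʳ ∨-upperˡ ∨-isConsequence , ∨-least ∨-upperʳ ∨-upperˡ ∨-isConsequence

  x≤y⇒x∨y≅y : ∀ {A B} → A ≤ B → IsConsequence B → (A ∨ B) ≅ B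
  x≤y⇒x∨y≅y A≤B isB = ∨-least A≤B id isB , ∨-upperʳ

  y≤x⇒x∨y≅x : ∀ {A B} → B ≤ A → IsConsequence A → (A ∨ B) ≅ A
  y≤x⇒x∨y≅x B≤A isA = ∨-least id B≤A isA , ∨-upperˡ

  data Reduced : Set where
    ˡ ʳ ˡʳ ʳˡ : Reduced

  letter : LR → Reduced
  letter l = ˡ
  letter r = ʳ

  _◃_ : Reduced → LR → Reduced
  ˡ  ◃ l = ˡ
  ʳ  ◃ l = ʳˡ
  ˡʳ ◃ l = ʳˡ
  ʳˡ ◃ l = ʳˡ
  ˡ  ◃ r = ˡʳ
  ʳ  ◃ r = ʳ
  ˡʳ ◃ r = ˡʳ
  ʳˡ ◃ r = ʳˡ

  reduce : LR → List LR → Reduced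
  reduce u s = foldl _◃_ (letter u) s

  ʳˡ-absorbing : ∀ s → foldl _◃_ ʳˡ s ≡ ʳˡ
  ʳˡ-absorbing []      = refl
  ʳˡ-absorbing (l ∷ s) = ʳˡ-absorbing s
  ʳˡ-absorbing (r ∷ s) = ʳˡ-absorbing s

  data Vertex : Set where
    ⊤ ˡ∨ʳ : Vertex
    word  : Reduced → Vertex

  module Classification (⊢ : Cons) (isLogic : IsLogic ⊢) (noAntitheorem : ¬ HasAntitheorem ⊢) where

    private
      isConsequence : IsConsequence ⊢
      isConsequence = isLogic⇒isConsequence isLogic

      mono : Monotone ⊢
      mono = IsConsequence.monotone isConsequence

      noAntitheoremˡ : ¬ HasAntitheorem (lOp ⊢)
      noAntitheoremˡ = ¬HasAntitheorem-≤ {lOp ⊢} {⊢} (lOp-≤ {⊢} mono) noAntitheorem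

    ⟦_⟧ʳ : Reduced → Cons
    ⟦ ˡ  ⟧ʳ = lOp ⊢
    ⟦ ʳ  ⟧ʳ = rOp ⊢
    ⟦ ˡʳ ⟧ʳ = rOp (lOp ⊢)
    ⟦ ʳˡ ⟧ʳ = lOp (rOp ⊢)

    ⟦_⟧ : Vertex → Cons
    ⟦ ⊤     ⟧ = ⊢
    ⟦ ˡ∨ʳ   ⟧ = lOp ⊢ ∨ rOp ⊢
    ⟦ word w ⟧ = ⟦ w ⟧ʳ

    ◃-sound : ∀ w u → applyLR u ⟦ w ⟧ʳ ≅ ⟦ w ◃ u ⟧ʳ
    ◃-sound ˡ  l = lOp-idem
    ◃-sound ʳ  l = ≅-refl
    ◃-sound ˡʳ l = lrl≅rl mono noAntitheorem
    ◃-sound ʳˡ l = lOp-idem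
    ◃-sound ˡ  r = ≅-refl
    ◃-sound ʳ  r = rOp-idem noAntitheorem
    ◃-sound ˡʳ r = rOp-idem noAntitheoremˡ
    ◃-sound ʳˡ r = rlr≅rl mono noAntitheorem

    foldl-sound : ∀ s w {A} → A ≅ ⟦ w ⟧ʳ → foldl (λ L u → applyLR u L) A s ≅ ⟦ foldl _◃_ w s ⟧ʳ
    foldl-sound []      w A≅w = A≅w
    foldl-sound (l ∷ s) w A≅w = foldl-sound s (w ◃ l) (≅-trans (lOp-cong A≅w) (◃-sound w l))
    foldl-sound (r ∷ s) w A≅w = foldl-sound s (w ◃ r) (≅-trans (rOp-cong A≅w) (◃-sound w r))

    iter-sound : ∀ u s → iter ⊢ (u ∷ s) ≅ ⟦ reduce u s ⟧ʳ
    iter-sound l s = foldl-sound s ˡ ≅-refl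
    iter-sound r s = foldl-sound s ʳ ≅-refl

    iter-ʳˡ : ∀ u s → reduce u s ≡ ʳˡ → iter ⊢ (u ∷ s) ≅ ⟦ ʳˡ ⟧ʳ
    iter-ʳˡ u s eq = subst (λ w → iter ⊢ (u ∷ s) ≅ ⟦ w ⟧ʳ) eq (iter-sound u s)

    ˡʳ≤ˡ : ⟦ ˡʳ ⟧ʳ ≤ ⟦ ˡ ⟧ʳ
    ˡʳ≤ˡ = lr≤l mono noAntitheorem

    ˡʳ≤ʳ : ⟦ ˡʳ ⟧ʳ ≤ ⟦ ʳ ⟧ʳ
    ˡʳ≤ʳ = lr≤r mono noAntitheorem

    ʳˡ≤ˡʳ : ⟦ ʳˡ ⟧ʳ ≤ ⟦ ˡʳ ⟧ʳ
    ʳˡ≤ˡʳ = rl≤lr mono noAntitheorem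

    ˡ∩ʳ≅ˡʳ : (⟦ ˡ ⟧ʳ ∩ ⟦ ʳ ⟧ʳ) ≅ ⟦ ˡʳ ⟧ʳ
    ˡ∩ʳ≅ˡʳ = l∩r≅lr mono noAntitheorem

    ʳˡ-least : ∀ w → ⟦ ʳˡ ⟧ʳ ≤ ⟦ w ⟧ʳ
    ʳˡ-least ˡ  p = ˡʳ≤ˡ (ʳˡ≤ˡʳ p)
    ʳˡ-least ʳ  p = ˡʳ≤ʳ (ʳˡ≤ˡʳ p)
    ʳˡ-least ˡʳ p = ʳˡ≤ˡʳ p
    ʳˡ-least ʳˡ p = p

    word≤ˡ∨ʳ : ∀ w → ⟦ w ⟧ʳ ≤ ⟦ ˡ∨ʳ ⟧
    word≤ˡ∨ʳ ˡ  p = ∨-upperˡ p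
    word≤ˡ∨ʳ ʳ  p = ∨-upperʳ p
    word≤ˡ∨ʳ ˡʳ p = ∨-upperˡ (ˡʳ≤ˡ p)
    word≤ˡ∨ʳ ʳˡ p = ∨-upperˡ (ˡʳ≤ˡ (ʳˡ≤ˡʳ p))

    ˡ∨ʳ≤⊤ : ⟦ ˡ∨ʳ ⟧ ≤ ⊢
    ˡ∨ʳ≤⊤ = ∨-least (lOp-≤ {⊢} mono) (rOp-≤ {⊢} noAntitheorem) isConsequence

    ≤⊤ : ∀ v → ⟦ v ⟧ ≤ ⊢
    ≤⊤ ⊤        p = p
    ≤⊤ ˡ∨ʳ      p = ˡ∨ʳ≤⊤ p
    ≤⊤ (word w) p = ˡ∨ʳ≤⊤ (word≤ˡ∨ʳ w p)

    ⟦⟧-isConsequence : ∀ v → IsConsequence ⟦ v ⟧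
    ⟦⟧-isConsequence ⊤         = isConsequence
    ⟦⟧-isConsequence ˡ∨ʳ       = ∨-isConsequence
    ⟦⟧-isConsequence (word ˡ)  = lOp-isConsequence isConsequence
    ⟦⟧-isConsequence (word ʳ)  = rOp-isConsequence noAntitheorem isConsequence
    ⟦⟧-isConsequence (word ˡʳ) = rOp-isConsequence noAntitheoremˡ (lOp-isConsequence isConsequence)
    ⟦⟧-isConsequence (word ʳˡ) = lOp-isConsequence (rOp-isConsequence noAntitheorem isConsequence)

    data Comparison : Vertex → Vertex → Set₁ where
      below : ∀ {v w} → ⟦ v ⟧ ≤ ⟦ w ⟧ → Comparison v w
      above : ∀ {v w} → ⟦ w ⟧ ≤ ⟦ v ⟧ → Comparison v w
      ˡ∥ʳ   : Comparison (word ˡ) (word ʳ)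
      ʳ∥ˡ   : Comparison (word ʳ) (word ˡ)

    compare : ∀ v w → Comparison v w
    compare v                ⊤                = below (≤⊤ v)
    compare ⊤                w                = above (≤⊤ w)
    compare ˡ∨ʳ              ˡ∨ʳ              = below id
    compare ˡ∨ʳ              (word w)         = above (word≤ˡ∨ʳ w)
    compare (word w)         ˡ∨ʳ              = below (word≤ˡ∨ʳ w)
    compare (word w)         (word ʳˡ)        = above (ʳˡ-least w)
    compare (word ʳˡ)        (word w)         = below (ʳˡ-least w)
    compare (word ˡ)         (word ˡ)         = below id
    compare (word ˡ)         (word ʳ)         = ˡ∥ʳ
    compare (word ˡ)         (word ˡʳ)        = above ˡʳ≤ˡ
    compare (word ʳ)         (word ˡ)         = ʳ∥ˡ
    compare (word ʳ)         (word ʳ)         = below id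
    compare (word ʳ)         (word ˡʳ)        = above ˡʳ≤ʳ
    compare (word ˡʳ)        (word ˡ)         = below ˡʳ≤ˡ
    compare (word ˡʳ)        (word ʳ)         = below ˡʳ≤ʳ
    compare (word ˡʳ)        (word ˡʳ)        = below id

    ∩-closed : ∀ {v w} → Comparison v w → Σ Vertex λ m → (⟦ v ⟧ ∩ ⟦ w ⟧) ≅ ⟦ m ⟧
    ∩-closed {v}     (below v≤w) = v , x≤y⇒x∩y≅x v≤w
    ∩-closed {w = w} (above w≤v) = w , y≤x⇒x∩y≅y w≤v
    ∩-closed ˡ∥ʳ = word ˡʳ , ˡ∩ʳ≅ˡʳ
    ∩-closed ʳ∥ˡ = word ˡʳ , ≅-trans ∩-comm ˡ∩ʳ≅ˡʳ

    ∨-closed : ∀ {v w} → Comparison v w → Σ Vertex λ m → (⟦ v ⟧ ∨ ⟦ w ⟧) ≅ ⟦ m ⟧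
    ∨-closed {w = w} (below v≤w) = w , x≤y⇒x∨y≅y v≤w (⟦⟧-isConsequence w)
    ∨-closed {v}     (above w≤v) = v , y≤x⇒x∨y≅x w≤v (⟦⟧-isConsequence v)
    ∨-closed ˡ∥ʳ = ˡ∨ʳ , ≅-refl
    ∨-closed ʳ∥ˡ = ˡ∨ʳ , ∨-comm

    gen-classification : ∀ {L} → Gen ⊢ L → Σ Vertex λ v → L ≅ ⟦ v ⟧
    gen-classification (sv u s) = word (reduce u s) , iter-sound u s
    gen-classification (meet gA gB) =
      let (v , A≅v) = gen-classification gA
          (w , B≅w) = gen-classification gB
          (m , v∩w≅m) = ∩-closed (compare v w)
      in m , ≅-trans (∩-cong A≅v B≅w) v∩w≅m
    gen-classification (join gA gB) =
      let (v , A≅v) = gen-classification gA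
          (w , B≅w) = gen-classification gB
          (m , v∨w≅m) = ∨-closed (compare v w)
      in m , ≅-trans (∨-cong A≅v B≅w) v∨w≅m

    word-cases : ∀ {L} w → L ≅ ⟦ w ⟧ʳ →
      L ≅ ⟦ ˡ ⟧ʳ ⊎ L ≅ ⟦ ʳ ⟧ʳ ⊎ L ≅ ⟦ ˡʳ ⟧ʳ ⊎ L ≅ ⟦ ʳˡ ⟧ʳ
    word-cases ˡ  L≅w = inj₁ L≅w
    word-cases ʳ  L≅w = inj₂ (inj₁ L≅w)
    word-cases ˡʳ L≅w = inj₂ (inj₂ (inj₁ L≅w))
    word-cases ʳˡ L≅w = inj₂ (inj₂ (inj₂ L≅w))

    vertex-cases : ∀ {L} v → L ≅ ⟦ v ⟧ →
      L ≅ ⊢ ⊎ L ≅ ⟦ ˡ∨ʳ ⟧ ⊎ L ≅ ⟦ ˡ ⟧ʳ ⊎ L ≅ ⟦ ʳ ⟧ʳ ⊎ L ≅ ⟦ ˡʳ ⟧ʳ ⊎ L ≅ ⟦ ʳˡ ⟧ʳ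
    vertex-cases ⊤        L≅v = inj₁ L≅v
    vertex-cases ˡ∨ʳ      L≅v = inj₂ (inj₁ L≅v)
    vertex-cases (word w) L≅v = inj₂ (inj₂ (word-cases w L≅v))

corollary4p6 : (𝓛 : Language) → let open WithLanguage 𝓛 in
    (⊢ : Cons) → IsLogic ⊢ → Finitary ⊢ →
    (x y : ℕ) (π : Fm) → IsBinaryFormula x y π →
    IsLPartition (lOp ⊢) x y π → IsRPartition (rOp ⊢) x y π →
    ¬ HasAntitheorem ⊢ →
    let ⊢l = iter ⊢ (l ∷ [])
        ⊢r = iter ⊢ (r ∷ [])
        ⊢lr = iter ⊢ (l ∷ r ∷ [])
        ⊢rl = iter ⊢ (r ∷ l ∷ [])
    in
    -- (i)
    (∀ (u : LR) (s : List LR) → let L = iter ⊢ (u ∷ s) in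
      L ≅ ⊢ ⊎ L ≅ ⊢l ⊎ L ≅ ⊢r ⊎ L ≅ ⊢lr ⊎ L ≅ ⊢rl)
    -- (ii)
    × (∀ L → Gen ⊢ L →
      L ≅ ⊢ ⊎ L ≅ (⊢l ∨ ⊢r) ⊎ L ≅ ⊢l ⊎ L ≅ ⊢r ⊎ L ≅ ⊢lr ⊎ L ≅ ⊢rl)
    × (⊢lr ≅ (⊢l ∩ ⊢r))
    × (∀ (s : List LR) → iter ⊢ (r ∷ l ∷ s) ≅ ⊢rl)
    × (∀ (s : List LR) → iter ⊢ (l ∷ r ∷ l ∷ s) ≅ ⊢rl)
    × (⊢rl ≤ ⊢lr) × (⊢lr ≤ ⊢l) × (⊢lr ≤ ⊢r)
    × (⊢l ≤ (⊢l ∨ ⊢r)) × (⊢r ≤ (⊢l ∨ ⊢r)) × ((⊢l ∨ ⊢r) ≤ ⊢)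
corollary4p6 𝓛 ⊢ isLogic _ _ _ _ _ _ _ noAntitheorem =
    (λ u s → inj₂ (word-cases (reduce u s) (iter-sound u s)))
  , (λ _ g → let (v , L≅v) = gen-classification g in vertex-cases v L≅v)
  , ≅-sym ˡ∩ʳ≅ˡʳ
  , (λ s → iter-ʳˡ r (l ∷ s) (ʳˡ-absorbing s))
  , (λ s → iter-ʳˡ l (r ∷ l ∷ s) (ʳˡ-absorbing s))
  , ʳˡ≤ˡʳ , ˡʳ≤ˡ , ˡʳ≤ʳ , ∨-upperˡ , ∨-upperʳ , ˡ∨ʳ≤⊤
  where
  open WithLanguage 𝓛
  open SublogicsOfVariableInclusion 𝓛
  open Classification ⊢ isLogic noAntitheorem
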